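{- Let $k, s \ge 1$ be integers. Let $G$ be a properly edge-coloured graph and let $x, y \in V(G)$. Suppose that $\hom^*_{x, y}(C_{2k}) < \frac{1}{s^2}\hom_{x, y}(C_{2k})$. Then there are $s$ pairwise colour-disjoint and internally vertex-disjoint rainbow paths of length $k$ from $x$ to $y$.
   Context: A proper edge-colouring gives distinct colours to edges sharing a vertex; a subgraph is rainbow if its edges have distinct colours. $\mathrm{Hom}_{x,y}(C_{2k})$ is the family of closed walks $(x_1,\dots,x_{2k})$ of length $2k$ (consecutive vertices adjacent and $x_{2k}x_1$ an edge) with $x_1=x$ and $x_{k+1}=y$; $\hom_{x,y}(C_{2k})$ is its size. $\mathrm{Hom}^*_{x,y}(C_{2k})$ is the subfamily of those closed walks that do not form a rainbow copy of $C_{2k}$ (two of the $2k$ vertices coincide or two of the $2k$ edges share a colour), and $\hom^*_{x,y}(C_{2k})$ is its size. -}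

module Defs where

open import Data.Nat as ℕ using (ℕ; zero; suc; _+_; _*_; _<_; _≤_)
open import Data.Nat.DivMod using (_%_; m%n<n)
open import Data.Fin as Fin using (Fin; toℕ; fromℕ; fromℕ<; inject₁)
open import Data.Fin.Properties using (all?)
open import Data.Vec using (Vec; []; _∷_; lookup)
open import Data.List using (List; []; _∷_; concatMap; map; filter; length)
open import Data.Product using (_×_; _,_; Σ; ∃)
open import Relation.Nullary using (¬_; Dec; yes; no)
open import Relation.Nullary.Decidable using (¬?; _→-dec_; _×-dec_)
open import Relation.Binary using (Decidable)
open import Relation.Binary.PropositionalEquality using (_≡_; _≢_)

record Graph (n : ℕ) : Set₁ where
  field
    Adj     : Fin n → Fin n → Set
    adj?    : Decidable Adj
    sym     : ∀ {u v} → Adj u v → Adj v u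
    irrefl  : ∀ {u} → ¬ Adj u u
open Graph public

-- An edge-colouring with colours in ℕ: col u v is the colour of the edge uv
-- (values on non-edges are irrelevant).
ProperEdgeColouring : ∀ {n} → Graph n → (Fin n → Fin n → ℕ) → Set
ProperEdgeColouring {n} G col =
  (∀ {u v} → Adj G u v → col u v ≡ col v u) ×
  (∀ {u v w} → Adj G u v → Adj G u w → v ≢ w → col u v ≢ col u w)

cyc : ∀ {L} → Fin L → Fin L
cyc {suc L} i = fromℕ< (m%n<n (suc (toℕ i)) (suc L))

allVecs : (n m : ℕ) → List (Vec (Fin n) m)
allVecs n zero = [] ∷ []
allVecs n (suc m) = concatMap (λ v → map (_∷ v) (Data.List.tabulate {n = n} (λ i → i))) (allVecs n m)

count : ∀ {A : Set} {P : A → Set} → (∀ a → Dec (P a)) → List A → ℕ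
count P? xs = length (filter P? xs)

module _ {n : ℕ} (G : Graph n) (col : Fin n → Fin n → ℕ) where

  -- (x_1,…,x_{2k}) is a closed walk with x_1 = x and x_{k+1} = y
  -- (indices shifted to start at 0; the cycle has length k + k = 2k)
  InHom : (x y : Fin n) (k : ℕ) → Vec (Fin n) (k + k) → Set
  InHom x y k w =
    (∀ i → Adj G (lookup w i) (lookup w (cyc i))) ×
    (∀ i → toℕ i ≡ 0 → lookup w i ≡ x) ×
    (∀ i → toℕ i ≡ k → lookup w i ≡ y)

  RainbowCycle : ∀ {L} → Vec (Fin n) L → Set
  RainbowCycle w =
    (∀ i j → i ≢ j → lookup w i ≢ lookup w j) ×
    (∀ i j → i ≢ j → col (lookup w i) (lookup w (cyc i)) ≢ col (lookup w j) (lookup w (cyc j)))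

  InHom* : (x y : Fin n) (k : ℕ) → Vec (Fin n) (k + k) → Set
  InHom* x y k w = InHom x y k w × ¬ RainbowCycle w

  inHom? : ∀ x y k w → Dec (InHom x y k w)
  inHom? x y k w =
    all? (λ i → adj? G (lookup w i) (lookup w (cyc i))) ×-dec
    all? (λ i → (toℕ i ℕ.≟ 0) →-dec (lookup w i Fin.≟ x)) ×-dec
    all? (λ i → (toℕ i ℕ.≟ k) →-dec (lookup w i Fin.≟ y))

  rainbowCycle? : ∀ {L} (w : Vec (Fin n) L) → Dec (RainbowCycle w)
  rainbowCycle? w =
    all? (λ i → all? (λ j → ¬? (i Fin.≟ j) →-dec ¬? (lookup w i Fin.≟ lookup w j))) ×-dec
    all? (λ i → all? (λ j → ¬? (i Fin.≟ j) →-dec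
      ¬? (col (lookup w i) (lookup w (cyc i)) ℕ.≟ col (lookup w j) (lookup w (cyc j)))))

  inHom*? : ∀ x y k w → Dec (InHom* x y k w)
  inHom*? x y k w = inHom? x y k w ×-dec ¬? (rainbowCycle? w)

  hom : (x y : Fin n) (k : ℕ) → ℕ
  hom x y k = count (inHom? x y k) (allVecs n (k + k))

  hom* : (x y : Fin n) (k : ℕ) → ℕ
  hom* x y k = count (inHom*? x y k) (allVecs n (k + k))

  edgeCol : ∀ {k} → Vec (Fin n) (suc k) → Fin k → ℕ
  edgeCol p i = col (lookup p (inject₁ i)) (lookup p (Fin.suc i))

  RainbowPath : (x y : Fin n) (k : ℕ) → Vec (Fin n) (suc k) → Set
  RainbowPath x y k p =
    lookup p Fin.zero ≡ x ×
    lookup p (fromℕ k) ≡ y ×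
    (∀ (i : Fin k) → Adj G (lookup p (inject₁ i)) (lookup p (Fin.suc i))) ×
    (∀ i j → i ≢ j → lookup p i ≢ lookup p j) ×
    (∀ (i j : Fin k) → i ≢ j → edgeCol p i ≢ edgeCol p j)

  Internal : ∀ {k} → Fin (suc k) → Set
  Internal {k} i = 0 < toℕ i × toℕ i < k

  DisjointRainbowPaths : (s : ℕ) (x y : Fin n) (k : ℕ) → Set
  DisjointRainbowPaths s x y k =
    Σ (Fin s → Vec (Fin n) (suc k)) λ P →
      (∀ a → RainbowPath x y k (P a)) ×
      (∀ a b → a ≢ b → ∀ (i j : Fin k) → edgeCol (P a) i ≢ edgeCol (P b) j) ×
      (∀ a b → a ≢ b → ∀ (i j : Fin (suc k)) → Internal i → Internal j →
         lookup (P a) i ≢ lookup (P b) j)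

{-# OPTIONS --safe #-}

-- A closed walk of length 2k with x at position 0 and y at position k is an ordered pair (e, e′)
-- of walks of length k from x to y, glued as e followed by e′ reversed.  Hence hom = W² for the
-- number W of such walks, and hom* counts the pairs whose gluing is not a rainbow cycle.  Pick s
-- walks independently and uniformly at random.  The expected number of ordered pairs of distinct
-- picks with a non-rainbow gluing is at most s(s − 1)·hom*/W², and each pick has no rainbow partner
-- at all with probability at most hom*/W²; so the expected number of defects is at most
-- s²·hom*/W² < 1 and some choice has none.  Any two chosen walks then glue to a rainbow 2k-cycle,
-- so they are rainbow paths with disjoint colours and disjoint interiors.  The expectation is
-- computed as an exact sum over all s-tuples.

module Submission where

open import Defs hiding (sym)
open import Algebra.Properties.CommutativeSemigroup using (interchange)
open import Data.Empty using (⊥-elim)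
open import Data.Fin as Fin using (Fin; toℕ; fromℕ; fromℕ<; inject₁)
open import Data.Fin.Properties
  using (all?; fromℕ<-injective; toℕ-fromℕ<; toℕ-fromℕ; toℕ-inject₁; toℕ-injective; toℕ<n)
  renaming (suc-injective to Fin-suc-injective)
open import Data.List using (List; []; _∷_; [_]; concatMap; map; filter; length; allFin)
  renaming (_++_ to _++ₗ_)
open import Data.List.Properties using (map-tabulate)
open import Data.Nat
  using (ℕ; zero; suc; _+_; _*_; _∸_; _^_; _<_; _≤_; z≤n; s≤s; s≤s⁻¹; z<s; NonZero; >-nonZero)
open import Data.Nat.DivMod using (_%_; m%n<n; n%n≡0; m<n⇒m%n≡m)
open import Data.Nat.Properties
open import Data.Nat.Tactic.RingSolver using (solve-∀)
open import Data.Product using (_×_; _,_; ∃; proj₁; proj₂)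
open import Data.Sum using (_⊎_; inj₁; inj₂)
open import Data.Vec using (Vec; []; _∷_; lookup; _++_; _∷ʳ_; reverse; toList; tabulate)
open import Data.Vec.Properties using (lookup∘tabulate; reverse-∷)
open import Function using (_∘_)
open import Relation.Nullary using (¬_; Dec; yes; no; ¬?)
open import Relation.Nullary.Decidable using (_×-dec_)
open import Relation.Binary.PropositionalEquality
  using (_≡_; _≢_; refl; sym; trans; cong; cong₂; subst; subst₂; module ≡-Reasoning)

private variable
  A B : Set
  L M : ℕ

-- Finite sums

∑ : List A → (A → ℕ) → ℕ
∑ []      f = 0
∑ (a ∷ l) f = f a + ∑ l f

𝟙 : {P : Set} → Dec P → ℕ
𝟙 (yes _) = 1
𝟙 (no _)  = 0

𝟙≡1 : {P : Set} (P? : Dec P) → P → 𝟙 P? ≡ 1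
𝟙≡1 (yes _) _ = refl
𝟙≡1 (no ¬p) p = ⊥-elim (¬p p)

𝟙≡0 : {P : Set} (P? : Dec P) → ¬ P → 𝟙 P? ≡ 0
𝟙≡0 (yes p) ¬p = ⊥-elim (¬p p)
𝟙≡0 (no _)  _  = refl

𝟙-cong : {P Q : Set} (P? : Dec P) (Q? : Dec Q) → (P → Q) → (Q → P) → 𝟙 P? ≡ 𝟙 Q?
𝟙-cong (yes p) Q? f _ = sym (𝟙≡1 Q? (f p))
𝟙-cong (no ¬p) Q? _ g = sym (𝟙≡0 Q? (¬p ∘ g))

∑-cong : (l : List A) {f g : A → ℕ} → (∀ a → f a ≡ g a) → ∑ l f ≡ ∑ l g
∑-cong []      eq = refl
∑-cong (a ∷ l) eq = cong₂ _+_ (eq a) (∑-cong l eq)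

∑-++ : (l l′ : List A) (f : A → ℕ) → ∑ (l ++ₗ l′) f ≡ ∑ l f + ∑ l′ f
∑-++ []      l′ f = refl
∑-++ (a ∷ l) l′ f = trans (cong (f a +_) (∑-++ l l′ f)) (sym (+-assoc (f a) _ _))

∑-map : (h : A → B) (l : List A) (f : B → ℕ) → ∑ (map h l) f ≡ ∑ l (f ∘ h)
∑-map h []      f = refl
∑-map h (a ∷ l) f = cong (f (h a) +_) (∑-map h l f)

∑-concatMap : (g : A → List B) (l : List A) (f : B → ℕ) →
              ∑ (concatMap g l) f ≡ ∑ l (λ a → ∑ (g a) f)
∑-concatMap g []      f = refl
∑-concatMap g (a ∷ l) f = trans (∑-++ (g a) (concatMap g l) f) (cong (∑ (g a) f +_) (∑-concatMap g l f))

∑-+ : (l : List A) (f g : A → ℕ) → ∑ l (λ a → f a + g a) ≡ ∑ l f + ∑ l g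
∑-+ []      f g = refl
∑-+ (a ∷ l) f g =
  trans (cong (f a + g a +_) (∑-+ l f g)) (interchange +-commutativeSemigroup (f a) (g a) _ _)

∑-*ˡ : (l : List A) (c : ℕ) (f : A → ℕ) → ∑ l (λ a → c * f a) ≡ c * ∑ l f
∑-*ˡ []      c f = sym (*-zeroʳ c)
∑-*ˡ (a ∷ l) c f = trans (cong (c * f a +_) (∑-*ˡ l c f)) (sym (*-distribˡ-+ c (f a) (∑ l f)))

∑-*ʳ : (l : List A) (c : ℕ) (f : A → ℕ) → ∑ l (λ a → f a * c) ≡ ∑ l f * c
∑-*ʳ l c f = trans (∑-cong l (λ a → *-comm (f a) c)) (trans (∑-*ˡ l c f) (*-comm c (∑ l f)))

∑-const : (l : List A) (c : ℕ) → ∑ l (λ _ → c) ≡ length l * c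
∑-const []      c = refl
∑-const (a ∷ l) c = cong (c +_) (∑-const l c)

∑-zero : (l : List A) {f : A → ℕ} → (∀ a → f a ≡ 0) → ∑ l f ≡ 0
∑-zero []      z = refl
∑-zero (a ∷ l) z = cong₂ _+_ (z a) (∑-zero l z)

∑-swap : (l : List A) (l′ : List B) (f : A → B → ℕ) →
         ∑ l (λ a → ∑ l′ (f a)) ≡ ∑ l′ (λ b → ∑ l (λ a → f a b))
∑-swap []      l′ f = sym (∑-zero l′ (λ _ → refl))
∑-swap (a ∷ l) l′ f = trans (cong (∑ l′ (f a) +_) (∑-swap l l′ f)) (sym (∑-+ l′ (f a) _))

∑-mono-≤ : (l : List A) {f g : A → ℕ} → (∀ a → f a ≤ g a) → ∑ l f ≤ ∑ l g
∑-mono-≤ []      le = z≤n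
∑-mono-≤ (a ∷ l) le = +-mono-≤ (le a) (∑-mono-≤ l le)

∑-filter : {P : A → Set} (P? : ∀ a → Dec (P a)) (l : List A) {f : A → ℕ} →
           (∀ a → ¬ P a → f a ≡ 0) → ∑ (filter P? l) f ≡ ∑ l f
∑-filter P? []      z = refl
∑-filter P? (a ∷ l) {f} z with P? a
... | yes _ = cong (_ +_) (∑-filter P? l z)
... | no ¬p = trans (∑-filter P? l z) (cong (_+ ∑ l f) (sym (z a ¬p)))

∑-filter-cong : {P : A → Set} (P? : ∀ a → Dec (P a)) (l : List A) {f g : A → ℕ} →
                (∀ a → P a → f a ≡ g a) → ∑ (filter P? l) f ≡ ∑ (filter P? l) g
∑-filter-cong P? []      eq = refl
∑-filter-cong P? (a ∷ l) eq with P? a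
... | yes p = cong₂ _+_ (eq a p) (∑-filter-cong P? l eq)
... | no _  = ∑-filter-cong P? l eq

count≡∑𝟙 : {P : A → Set} (P? : ∀ a → Dec (P a)) (l : List A) → count P? l ≡ ∑ l (𝟙 ∘ P?)
count≡∑𝟙 P? []      = refl
count≡∑𝟙 P? (a ∷ l) with P? a
... | yes _ = cong suc (count≡∑𝟙 P? l)
... | no _  = count≡∑𝟙 P? l

∑<length⇒∃≡0 : (l : List A) (f : A → ℕ) → ∑ l f < length l → ∃ λ a → f a ≡ 0
∑<length⇒∃≡0 (a ∷ l) f lt with f a in eq
... | zero  = a , eq
... | suc v = ∑<length⇒∃≡0 l f (≤-trans (s≤s (m≤n+m (∑ l f) v)) (s≤s⁻¹ lt))

∑≡0⇒lookup≡0 : ∀ {s} (g : A → ℕ) (t : Vec A s) →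
               ∑ (toList t) g ≡ 0 → ∀ i → g (lookup t i) ≡ 0
∑≡0⇒lookup≡0 g (e ∷ t) z Fin.zero    = m+n≡0⇒m≡0 (g e) z
∑≡0⇒lookup≡0 g (e ∷ t) z (Fin.suc i) = ∑≡0⇒lookup≡0 g t (m+n≡0⇒n≡0 (g e) z) i

-- The first-moment argument

module FirstMoment (L : List A) (b : A → A → ℕ) where

  W Bad : ℕ
  W   = length L
  Bad = ∑ L (λ e → ∑ L (b e))

  tuples : ∀ s → List (Vec A s)
  tuples zero    = [ [] ]
  tuples (suc s) = concatMap (λ e → map (e ∷_) (tuples s)) L

  ∑-tuples-suc : ∀ s (f : Vec A (suc s) → ℕ) →
                 ∑ (tuples (suc s)) f ≡ ∑ L (λ e → ∑ (tuples s) (λ t → f (e ∷ t)))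
  ∑-tuples-suc s f = trans (∑-concatMap _ L f) (∑-cong L (λ e → ∑-map (e ∷_) (tuples s) f))

  ∑-tuples-const : ∀ s c → ∑ (tuples s) (λ _ → c) ≡ W ^ s * c
  ∑-tuples-const zero    c = refl
  ∑-tuples-const (suc s) c = begin
    ∑ (tuples (suc s)) (λ _ → c)        ≡⟨ ∑-tuples-suc s _ ⟩
    ∑ L (λ _ → ∑ (tuples s) (λ _ → c))  ≡⟨ ∑-const L _ ⟩
    W * ∑ (tuples s) (λ _ → c)          ≡⟨ cong (W *_) (∑-tuples-const s c) ⟩
    W * (W ^ s * c)                     ≡⟨ *-assoc W (W ^ s) c ⟨
    W ^ suc s * c                       ∎
    where open ≡-Reasoning

  length-tuples : ∀ s → length (tuples s) ≡ W ^ s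
  length-tuples s = begin
    length (tuples s)            ≡⟨ *-identityʳ _ ⟨
    length (tuples s) * 1        ≡⟨ ∑-const (tuples s) 1 ⟨
    ∑ (tuples s) (λ _ → 1)       ≡⟨ ∑-tuples-const s 1 ⟩
    W ^ s * 1                    ≡⟨ *-identityʳ _ ⟩
    W ^ s                        ∎
    where open ≡-Reasoning

  ∑-tuples-∑ : ∀ s (g : A → ℕ) → W * ∑ (tuples s) (λ t → ∑ (toList t) g) ≡ s * W ^ s * ∑ L g
  ∑-tuples-∑ zero    g = *-zeroʳ W
  ∑-tuples-∑ (suc s) g = begin
    W * ∑ (tuples (suc s)) (λ t → ∑ (toList t) g)
      ≡⟨ cong (W *_) (∑-tuples-suc s _) ⟩
    W * ∑ L (λ e → ∑ (tuples s) (λ t → g e + T t))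
      ≡⟨ cong (W *_) (∑-cong L (λ e → ∑-+ (tuples s) (λ _ → g e) T)) ⟩
    W * ∑ L (λ e → ∑ (tuples s) (λ _ → g e) + ∑ (tuples s) T)
      ≡⟨ cong (W *_) (∑-+ L _ _) ⟩
    W * (∑ L (λ e → ∑ (tuples s) (λ _ → g e)) + ∑ L (λ _ → ∑ (tuples s) T))
      ≡⟨ cong₂ (λ p q → W * (p + q)) (∑-cong L (λ e → ∑-tuples-const s (g e))) (∑-const L _) ⟩
    W * (∑ L (λ e → W ^ s * g e) + W * ∑ (tuples s) T)
      ≡⟨ cong₂ (λ p q → W * (p + q)) (∑-*ˡ L (W ^ s) g) (∑-tuples-∑ s g) ⟩
    W * (W ^ s * ∑ L g + s * W ^ s * ∑ L g)
      ≡⟨ regroup W (W ^ s) (∑ L g) s ⟩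
    suc s * (W * W ^ s) * ∑ L g ∎
    where
    open ≡-Reasoning
    T : Vec A s → ℕ
    T t = ∑ (toList t) g
    regroup : ∀ w p q s → w * (p * q + s * p * q) ≡ (1 + s) * (w * p) * q
    regroup = solve-∀

  -- Only relevant when s = 1: otherwise another entry of the tuple is a partner.
  isolated : A → ℕ
  isolated e = 𝟙 (W ≤? ∑ L (b e))

  isolated*W≤ : ∀ e → isolated e * W ≤ ∑ L (b e)
  isolated*W≤ e with W ≤? ∑ L (b e)
  ... | yes W≤ = ≤-trans (≤-reflexive (+-identityʳ W)) W≤
  ... | no _   = z≤n

  isolated≡0⇒partner : ∀ e → isolated e ≡ 0 → ∃ λ e′ → b e e′ ≡ 0
  isolated≡0⇒partner e z with W ≤? ∑ L (b e)
  ... | no W≰ = ∑<length⇒∃≡0 L (b e) (≰⇒> W≰)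

  pairBad : A → A → ℕ
  pairBad e e′ = b e e′ + b e′ e

  badDegree : A → ℕ
  badDegree e′ = ∑ L (λ e → pairBad e e′)

  defect : ∀ {s} → Vec A s → ℕ
  defect []      = 0
  defect (e ∷ t) = isolated e + ∑ (toList t) (pairBad e) + defect t

  ∑-isolated*W≤Bad : ∑ L isolated * W ≤ Bad
  ∑-isolated*W≤Bad = ≤-trans (≤-reflexive (sym (∑-*ʳ L W isolated))) (∑-mono-≤ L isolated*W≤)

  ∑-badDegree : ∑ L badDegree ≡ Bad + Bad
  ∑-badDegree = begin
    ∑ L (λ e′ → ∑ L (λ e → b e e′ + b e′ e))
      ≡⟨ ∑-cong L (λ e′ → ∑-+ L (λ e → b e e′) (b e′)) ⟩
    ∑ L (λ e′ → ∑ L (λ e → b e e′) + ∑ L (b e′))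
      ≡⟨ ∑-+ L _ _ ⟩
    ∑ L (λ e′ → ∑ L (λ e → b e e′)) + Bad
      ≡⟨ cong (_+ Bad) (∑-swap L L b) ⟨
    Bad + Bad ∎
    where open ≡-Reasoning

  ∑-defect-suc : ∀ s → ∑ (tuples (suc s)) defect ≡
    W ^ s * ∑ L isolated + ∑ (tuples s) (λ t → ∑ (toList t) badDegree) + W * ∑ (tuples s) defect
  ∑-defect-suc s = begin
    ∑ (tuples (suc s)) defect
      ≡⟨ ∑-tuples-suc s defect ⟩
    ∑ L (λ e → ∑ (tuples s) (λ t → isolated e + ∑ (toList t) (pairBad e) + defect t))
      ≡⟨ ∑-cong L (λ e → ∑-+ (tuples s) (λ t → isolated e + ∑ (toList t) (pairBad e)) defect) ⟩
    ∑ L (λ e → ∑ (tuples s) (λ t → isolated e + ∑ (toList t) (pairBad e)) + ∑ (tuples s) defect)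
      ≡⟨ ∑-cong L (λ e → cong (_+ ∑ (tuples s) defect) (∑-+ (tuples s) (λ _ → isolated e) _)) ⟩
    ∑ L (λ e → ∑ (tuples s) (λ _ → isolated e) + ∑ (tuples s) (λ t → ∑ (toList t) (pairBad e))
                 + ∑ (tuples s) defect)
      ≡⟨ trans (∑-+ L _ _) (cong₂ _+_ (∑-+ L _ _) (∑-const L _)) ⟩
    ∑ L (λ e → ∑ (tuples s) (λ _ → isolated e))
      + ∑ L (λ e → ∑ (tuples s) (λ t → ∑ (toList t) (pairBad e))) + W * ∑ (tuples s) defect
      ≡⟨ cong₂ (λ p q → p + q + W * ∑ (tuples s) defect) isolatedPart pairPart ⟩
    W ^ s * ∑ L isolated + ∑ (tuples s) (λ t → ∑ (toList t) badDegree) + W * ∑ (tuples s) defect ∎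
    where
    open ≡-Reasoning
    isolatedPart : ∑ L (λ e → ∑ (tuples s) (λ _ → isolated e)) ≡ W ^ s * ∑ L isolated
    isolatedPart = trans (∑-cong L (λ e → ∑-tuples-const s (isolated e))) (∑-*ˡ L (W ^ s) isolated)
    pairPart : ∑ L (λ e → ∑ (tuples s) (λ t → ∑ (toList t) (pairBad e)))
             ≡ ∑ (tuples s) (λ t → ∑ (toList t) badDegree)
    pairPart = trans (∑-swap L (tuples s) _) (∑-cong (tuples s) (λ t → ∑-swap L (toList t) pairBad))

  ∑-defect-bound : ∀ s → W * W * ∑ (tuples s) defect ≤ s * s * Bad * W ^ s
  ∑-defect-bound zero    = ≤-reflexive (*-zeroʳ (W * W))
  ∑-defect-bound (suc s) = begin
    W * W * ∑ (tuples (suc s)) defect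
      ≡⟨ cong (W * W *_) (∑-defect-suc s) ⟩
    W * W * (W ^ s * ∑ L isolated + C + W * D)
      ≡⟨ expand W (W ^ s) (∑ L isolated) C D ⟩
    W * W ^ s * (∑ L isolated * W) + W * (W * C) + W * (W * W * D)
      ≤⟨ +-mono-≤ (+-monoˡ-≤ _ (*-monoʳ-≤ (W * W ^ s) ∑-isolated*W≤Bad))
                  (*-monoʳ-≤ W (∑-defect-bound s)) ⟩
    W * W ^ s * Bad + W * (W * C) + W * (s * s * Bad * W ^ s)
      ≡⟨ cong (λ p → W * W ^ s * Bad + W * p + W * (s * s * Bad * W ^ s))
              (trans (∑-tuples-∑ s _) (cong (s * W ^ s *_) ∑-badDegree)) ⟩
    W * W ^ s * Bad + W * (s * W ^ s * (Bad + Bad)) + W * (s * s * Bad * W ^ s)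
      ≡⟨ collect W (W ^ s) Bad s ⟩
    suc s * suc s * Bad * (W * W ^ s) ∎
    where
    open ≤-Reasoning
    C D : ℕ
    C = ∑ (tuples s) (λ t → ∑ (toList t) badDegree)
    D = ∑ (tuples s) defect
    expand : ∀ w p r c d →
             w * w * (p * r + c + w * d) ≡ w * p * (r * w) + w * (w * c) + w * (w * w * d)
    expand = solve-∀
    collect : ∀ w p h s →
              w * p * h + w * (s * p * (h + h)) + w * (s * s * h * p) ≡ (1 + s) * (1 + s) * h * (w * p)
    collect = solve-∀

  Compatible : ∀ {s} → Vec A s → Set
  Compatible t = (∀ i → ∃ λ e′ → b (lookup t i) e′ ≡ 0)
               × (∀ i j → i ≢ j → b (lookup t i) (lookup t j) ≡ 0)

  defect≡0⇒compatible : ∀ {s} (t : Vec A s) → defect t ≡ 0 → Compatible t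
  defect≡0⇒compatible []      z = (λ ()) , (λ ())
  defect≡0⇒compatible (e ∷ t) z =
    (λ { Fin.zero → isolated≡0⇒partner e isolated≡0 ; (Fin.suc i) → proj₁ rest i }) ,
    (λ { Fin.zero Fin.zero ne → ⊥-elim (ne refl)
       ; Fin.zero (Fin.suc j) _ → m+n≡0⇒m≡0 _ (pairs≡0 j)
       ; (Fin.suc i) Fin.zero _ → m+n≡0⇒n≡0 _ (pairs≡0 i)
       ; (Fin.suc i) (Fin.suc j) ne → proj₂ rest i j (ne ∘ cong Fin.suc) })
    where
    head≡0 : isolated e + ∑ (toList t) (pairBad e) ≡ 0
    head≡0 = m+n≡0⇒m≡0 _ z
    isolated≡0 : isolated e ≡ 0
    isolated≡0 = m+n≡0⇒m≡0 _ head≡0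
    pairs≡0 : ∀ i → pairBad e (lookup t i) ≡ 0
    pairs≡0 = ∑≡0⇒lookup≡0 (pairBad e) t (m+n≡0⇒n≡0 (isolated e) head≡0)
    rest : Compatible t
    rest = defect≡0⇒compatible t (m+n≡0⇒n≡0 (isolated e + _) z)

  ∃-compatible : ∀ s → s * s * Bad < W * W → ∃ λ (t : Vec A s) → Compatible t
  ∃-compatible s hyp with ∑<length⇒∃≡0 (tuples s) defect (*-cancelˡ-< (W * W) _ _ scaled)
    where
    instance
      W≢0 : NonZero W
      W≢0 = m*n≢0⇒m≢0 W {{>-nonZero (≤-<-trans z≤n hyp)}}
    scaled : W * W * ∑ (tuples s) defect < W * W * length (tuples s)
    scaled = begin-strict
      W * W * ∑ (tuples s) defect  ≤⟨ ∑-defect-bound s ⟩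
      s * s * Bad * W ^ s          <⟨ *-monoˡ-< (W ^ s) {{>-nonZero (m^n>0 W s)}} hyp ⟩
      W * W * W ^ s                ≡⟨ cong (W * W *_) (length-tuples s) ⟨
      W * W * length (tuples s)    ∎
      where open ≤-Reasoning
  ... | t , z = t , defect≡0⇒compatible t z

∑-allFin-suc : ∀ p (f : Fin (suc p) → ℕ) →
               ∑ (allFin (suc p)) f ≡ f Fin.zero + ∑ (allFin p) (f ∘ Fin.suc)
∑-allFin-suc p f = cong (f Fin.zero +_)
  (trans (cong (λ l → ∑ l f) (sym (map-tabulate (λ i → i) Fin.suc))) (∑-map Fin.suc (allFin p) f))

∑-allFin-point : ∀ {p} (x : Fin p) (f : Fin p → ℕ) →
                 (∀ h → h ≢ x → f h ≡ 0) → ∑ (allFin p) f ≡ f x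
∑-allFin-point {suc p} Fin.zero f z = begin
  ∑ (allFin (suc p)) f                     ≡⟨ ∑-allFin-suc p f ⟩
  f Fin.zero + ∑ (allFin p) (f ∘ Fin.suc)  ≡⟨ cong (f Fin.zero +_) (∑-zero (allFin p) (λ h → z (Fin.suc h) (λ ()))) ⟩
  f Fin.zero + 0                           ≡⟨ +-identityʳ _ ⟩
  f Fin.zero                               ∎
  where open ≡-Reasoning
∑-allFin-point {suc p} (Fin.suc x) f z = begin
  ∑ (allFin (suc p)) f
    ≡⟨ ∑-allFin-suc p f ⟩
  f Fin.zero + ∑ (allFin p) (f ∘ Fin.suc)
    ≡⟨ cong₂ _+_ (z Fin.zero (λ ()))
                 (∑-allFin-point x (f ∘ Fin.suc) (λ h h≢x → z (Fin.suc h) (h≢x ∘ Fin-suc-injective))) ⟩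
  f (Fin.suc x) ∎
  where open ≡-Reasoning

module _ (n : ℕ) where

  ∑-allVecs-∷ : ∀ M (f : Vec (Fin n) (suc M) → ℕ) →
                ∑ (allVecs n (suc M)) f ≡ ∑ (allVecs n M) (λ v → ∑ (allFin n) (λ i → f (i ∷ v)))
  ∑-allVecs-∷ M f =
    trans (∑-concatMap _ (allVecs n M) f) (∑-cong (allVecs n M) (λ v → ∑-map (_∷ v) (allFin n) f))

  ∑-allVecs-++ : ∀ a b (f : Vec (Fin n) (a + b) → ℕ) →
                 ∑ (allVecs n (a + b)) f ≡ ∑ (allVecs n b) (λ u → ∑ (allVecs n a) (λ v → f (v ++ u)))
  ∑-allVecs-++ zero    b f = ∑-cong (allVecs n b) (λ u → sym (+-identityʳ (f u)))
  ∑-allVecs-++ (suc a) b f = trans (∑-allVecs-∷ (a + b) f) (trans (∑-allVecs-++ a b _)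
    (∑-cong (allVecs n b) (λ u → sym (∑-allVecs-∷ a (λ v → f (v ++ u))))))

  ∑-allVecs-∷ʳ : ∀ M (f : Vec (Fin n) (suc M) → ℕ) →
                 ∑ (allVecs n (suc M)) f ≡ ∑ (allVecs n M) (λ v → ∑ (allFin n) (λ i → f (v ∷ʳ i)))
  ∑-allVecs-∷ʳ zero    f = ∑-allVecs-∷ zero f
  ∑-allVecs-∷ʳ (suc M) f = begin
    ∑ (allVecs n (suc (suc M))) f
      ≡⟨ ∑-allVecs-∷ (suc M) f ⟩
    ∑ (allVecs n (suc M)) (λ v → ∑ (allFin n) (λ i → f (i ∷ v)))
      ≡⟨ ∑-allVecs-∷ʳ M _ ⟩
    ∑ (allVecs n M) (λ v → ∑ (allFin n) (λ j → ∑ (allFin n) (λ i → f (i ∷ (v ∷ʳ j)))))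
      ≡⟨ ∑-cong (allVecs n M) (λ v → ∑-swap (allFin n) (allFin n) _) ⟩
    ∑ (allVecs n M) (λ v → ∑ (allFin n) (λ i → ∑ (allFin n) (λ j → f ((i ∷ v) ∷ʳ j))))
      ≡⟨ ∑-allVecs-∷ M _ ⟨
    ∑ (allVecs n (suc M)) (λ v → ∑ (allFin n) (λ i → f (v ∷ʳ i))) ∎
    where open ≡-Reasoning

  ∑-allVecs-reverse : ∀ M (f : Vec (Fin n) M → ℕ) →
                      ∑ (allVecs n M) (f ∘ reverse) ≡ ∑ (allVecs n M) f
  ∑-allVecs-reverse zero    f = refl
  ∑-allVecs-reverse (suc M) f = begin
    ∑ (allVecs n (suc M)) (f ∘ reverse)
      ≡⟨ ∑-allVecs-∷ M _ ⟩
    ∑ (allVecs n M) (λ v → ∑ (allFin n) (λ i → f (reverse (i ∷ v))))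
      ≡⟨ ∑-cong (allVecs n M) (λ v → ∑-cong (allFin n) (λ i → cong f (reverse-∷ i v))) ⟩
    ∑ (allVecs n M) (λ v → ∑ (allFin n) (λ i → f (reverse v ∷ʳ i)))
      ≡⟨ ∑-allVecs-reverse M (λ w → ∑ (allFin n) (λ i → f (w ∷ʳ i))) ⟩
    ∑ (allVecs n M) (λ v → ∑ (allFin n) (λ i → f (v ∷ʳ i)))
      ≡⟨ ∑-allVecs-∷ʳ M f ⟨
    ∑ (allVecs n (suc M)) f ∎
    where open ≡-Reasoning

index : A → Vec A L → ℕ → A
index d []      j       = d
index d (a ∷ v) zero    = a
index d (a ∷ v) (suc j) = index d v j

lookup≡index : (d : A) (v : Vec A L) (i : Fin L) → lookup v i ≡ index d v (toℕ i)
lookup≡index d (a ∷ v) Fin.zero    = refl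
lookup≡index d (a ∷ v) (Fin.suc i) = lookup≡index d v i

index-length : (d : A) (v : Vec A L) → index d v L ≡ d
index-length d []      = refl
index-length d (a ∷ v) = index-length d v

index-++ˡ : (d d′ : A) (v : Vec A L) (u : Vec A M) (j : ℕ) →
            j < L → index d (v ++ u) j ≡ index d′ v j
index-++ˡ d d′ (a ∷ v) u zero    lt       = refl
index-++ˡ d d′ (a ∷ v) u (suc j) (s≤s lt) = index-++ˡ d d′ v u j lt

index-++ʳ : (d : A) (v : Vec A L) (u : Vec A M) (j : ℕ) → index d (v ++ u) (L + j) ≡ index d u j
index-++ʳ d []      u j = refl
index-++ʳ d (a ∷ v) u j = index-++ʳ d v u j

index-∷ʳ : (d : A) (v : Vec A L) (a : A) (j : ℕ) → j < L → index d (v ∷ʳ a) j ≡ index d v j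
index-∷ʳ d (b ∷ v) a zero    lt       = refl
index-∷ʳ d (b ∷ v) a (suc j) (s≤s lt) = index-∷ʳ d v a j lt

index-∷ʳ-length : (d : A) (v : Vec A L) (a : A) → index d (v ∷ʳ a) L ≡ a
index-∷ʳ-length d []      a = refl
index-∷ʳ-length d (b ∷ v) a = index-∷ʳ-length d v a

index-reverse : (d d′ : A) (v : Vec A L) (t j : ℕ) →
                suc (t + j) ≡ L → index d (reverse v) t ≡ index d′ v j
index-reverse d d′ (a ∷ v) t j eq rewrite reverse-∷ a v with j
... | zero with refl ← trans (cong suc (sym (+-identityʳ t))) eq = index-∷ʳ-length d (reverse v) a
... | suc j = trans (index-∷ʳ d (reverse v) a t t<) (index-reverse d d′ v t j eq′)
  where
  eq′ : suc (t + j) ≡ _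
  eq′ = suc-injective (trans (cong suc (sym (+-suc t j))) eq)
  t< : t < _
  t< = ≤-trans (s≤s (m≤m+n t j)) (≤-reflexive eq′)

-- Closed walks as pairs of walks

module Halves {n : ℕ} (G : Graph n) (col : Fin n → Fin n → ℕ) (x y : Fin n) (m : ℕ) where

  k N : ℕ
  k = suc m
  N = k + k

  k<N : k < N
  k<N = m<m+n k z<s

  -- A walk x → y of length k is stored as its vector e of interior vertices; glue e e′ runs along e
  -- and back along e′.  Vertices are read by position, with default y (resp. x) past the end.
  path : Vec (Fin n) m → ℕ → Fin n
  path e = index y (x ∷ e)

  path-k : ∀ e → path e k ≡ y
  path-k e = index-length y e

  Walk : Vec (Fin n) m → Set
  Walk e = ∀ (i : Fin k) → Adj G (path e (toℕ i)) (path e (suc (toℕ i)))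

  walk? : ∀ e → Dec (Walk e)
  walk? e = all? (λ i → adj? G (path e (toℕ i)) (path e (suc (toℕ i))))

  walk-edge : ∀ {e} → Walk e → ∀ j → j < k → Adj G (path e j) (path e (suc j))
  walk-edge {e} w j lt = subst (λ i → Adj G (path e i) (path e (suc i))) (toℕ-fromℕ< lt) (w (fromℕ< lt))

  glue : Vec (Fin n) m → Vec (Fin n) m → Vec (Fin n) N
  glue e e′ = x ∷ (e ++ (y ∷ reverse e′))

  vertex : Vec (Fin n) m → Vec (Fin n) m → ℕ → Fin n
  vertex e e′ = index x (glue e e′)

  vertex-front : ∀ e e′ j → j ≤ k → vertex e e′ j ≡ path e j
  vertex-front e e′ zero    _  = refl
  vertex-front e e′ (suc j) (s≤s j≤m) with m≤n⇒m<n∨m≡n j≤m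
  ... | inj₁ j<m  = index-++ˡ x y e (y ∷ reverse e′) j j<m
  ... | inj₂ refl = begin
    index x (e ++ (y ∷ reverse e′)) m        ≡⟨ cong (index x (e ++ (y ∷ reverse e′))) (+-identityʳ m) ⟨
    index x (e ++ (y ∷ reverse e′)) (m + 0)  ≡⟨ index-++ʳ x e (y ∷ reverse e′) 0 ⟩
    y                                        ≡⟨ path-k e ⟨
    path e (suc m)                           ∎
    where open ≡-Reasoning

  vertex-back : ∀ e e′ t j → t + j ≡ k → vertex e e′ (k + t) ≡ path e′ j
  vertex-back e e′ t j eq = trans (index-++ʳ x e (y ∷ reverse e′) t) (second-half t j eq)
    where
    second-half : ∀ t j → t + j ≡ k → index x (y ∷ reverse e′) t ≡ path e′ j
    second-half zero    j       refl = sym (path-k e′)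
    second-half (suc t) zero    eq with refl ← trans (sym (+-identityʳ t)) (suc-injective eq) =
      index-length x (reverse e′)
    second-half (suc t) (suc j) eq =
      index-reverse x y e′ t j (trans (sym (+-suc t j)) (suc-injective eq))

  vertex-back-edge : ∀ e e′ j → j < k →
    vertex e e′ (k + (m ∸ j)) ≡ path e′ (suc j) ×
    vertex e e′ (suc (k + (m ∸ j))) ≡ path e′ j ×
    k + (m ∸ j) < N
  vertex-back-edge e e′ j (s≤s j≤m) =
    vertex-back e e′ (m ∸ j) (suc j) (trans (+-suc (m ∸ j) j) (cong suc (m∸n+n≡m j≤m))) ,
    trans (cong (vertex e e′) (sym (+-suc k (m ∸ j))))
          (vertex-back e e′ (suc (m ∸ j)) j (cong suc (m∸n+n≡m j≤m))) ,
    +-monoʳ-< k (s≤s (m∸n≤m m j))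

  lookup-glue : ∀ e e′ (i : Fin N) → lookup (glue e e′) i ≡ vertex e e′ (toℕ i)
  lookup-glue e e′ = lookup≡index x (glue e e′)

  -- The default makes position N read as x again, so the wrap-around edge needs no special case.
  lookup-glue-cyc : ∀ e e′ (i : Fin N) → lookup (glue e e′) (cyc i) ≡ vertex e e′ (suc (toℕ i))
  lookup-glue-cyc e e′ i = begin
    lookup (glue e e′) (cyc i)          ≡⟨ lookup-glue e e′ (cyc i) ⟩
    vertex e e′ (toℕ (cyc i))           ≡⟨ cong (vertex e e′) (toℕ-fromℕ< (m%n<n (suc (toℕ i)) N)) ⟩
    vertex e e′ (suc (toℕ i) % N)       ≡⟨ wrap (m≤n⇒m<n∨m≡n (toℕ<n i)) ⟩
    vertex e e′ (suc (toℕ i))           ∎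
    where
    open ≡-Reasoning
    wrap : ∀ {j} → j < N ⊎ j ≡ N → vertex e e′ (j % N) ≡ vertex e e′ j
    wrap (inj₁ lt)   = cong (vertex e e′) (m<n⇒m%n≡m lt)
    wrap (inj₂ refl) = trans (cong (vertex e e′) (n%n≡0 N)) (sym (index-length x (glue e e′)))

  lookup-glue-at : ∀ e e′ {j} (lt : j < N) → lookup (glue e e′) (fromℕ< lt) ≡ vertex e e′ j
  lookup-glue-at e e′ lt = trans (lookup-glue e e′ (fromℕ< lt)) (cong (vertex e e′) (toℕ-fromℕ< lt))

  lookup-glue-cyc-at : ∀ e e′ {j} (lt : j < N) →
                       lookup (glue e e′) (cyc (fromℕ< lt)) ≡ vertex e e′ (suc j)
  lookup-glue-cyc-at e e′ lt =
    trans (lookup-glue-cyc e e′ (fromℕ< lt)) (cong (vertex e e′ ∘ suc) (toℕ-fromℕ< lt))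

  glue-edge : ∀ e e′ → Walk e → Walk e′ → ∀ j → j < N → Adj G (vertex e e′ j) (vertex e e′ (suc j))
  glue-edge e e′ we we′ j j<N with j <? k
  ... | yes j<k =
    subst₂ (Adj G) (sym (vertex-front e e′ j (<⇒≤ j<k))) (sym (vertex-front e e′ (suc j) j<k))
      (walk-edge we j j<k)
  ... | no j≮k with t , refl ← m≤n⇒∃[o]m+o≡n (≮⇒≥ j≮k)
               with front , back , _ ← vertex-back-edge e e′ (m ∸ t) (s≤s (m∸n≤m m t))
               rewrite m∸[m∸n]≡n (s≤s⁻¹ (+-cancelˡ-< k t k j<N)) =
    subst₂ (Adj G) (sym front) (sym back) (Graph.sym G (walk-edge we′ (m ∸ t) (s≤s (m∸n≤m m t))))

  glue-inHom : ∀ {e e′} → Walk e → Walk e′ → InHom G col x y k (glue e e′)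
  glue-inHom {e} {e′} we we′ =
    (λ i → subst₂ (Adj G) (sym (lookup-glue e e′ i)) (sym (lookup-glue-cyc e e′ i))
             (glue-edge e e′ we we′ (toℕ i) (toℕ<n i))) ,
    (λ i i≡0 → trans (lookup-glue e e′ i) (cong (vertex e e′) i≡0)) ,
    (λ i i≡k → trans (lookup-glue e e′ i)
                 (trans (cong (vertex e e′) i≡k) (trans (vertex-front e e′ k ≤-refl) (path-k e))))

  inHom-edge : ∀ e e′ → InHom G col x y k (glue e e′) →
               ∀ j → j < N → Adj G (vertex e e′ j) (vertex e e′ (suc j))
  inHom-edge e e′ (adj , _) j lt =
    subst₂ (Adj G) (lookup-glue-at e e′ lt) (lookup-glue-cyc-at e e′ lt) (adj (fromℕ< lt))

  inHom⇒walks : ∀ e e′ → InHom G col x y k (glue e e′) → Walk e × Walk e′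
  inHom⇒walks e e′ h =
    (λ i → subst₂ (Adj G) (vertex-front e e′ (toℕ i) (<⇒≤ (toℕ<n i)))
                          (vertex-front e e′ (suc (toℕ i)) (toℕ<n i))
             (inHom-edge e e′ h (toℕ i) (<-trans (toℕ<n i) k<N))) ,
    (λ i → let front , back , lt = vertex-back-edge e e′ (toℕ i) (toℕ<n i) in
           Graph.sym G (subst₂ (Adj G) front back (inHom-edge e e′ h _ lt)))

  inHom-ends : ∀ h h′ (e e″ : Vec (Fin n) m) → InHom G col x y k (h ∷ (e ++ (h′ ∷ e″))) → h ≡ x × h′ ≡ y
  inHom-ends h h′ e e″ (_ , at0 , atk) =
    at0 Fin.zero refl , trans (sym middle) (atk (fromℕ< k<N) (toℕ-fromℕ< k<N))
    where
    w : Vec (Fin n) N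
    w = h ∷ (e ++ (h′ ∷ e″))
    open ≡-Reasoning
    middle : lookup w (fromℕ< k<N) ≡ h′
    middle = begin
      lookup w (fromℕ< k<N)             ≡⟨ lookup≡index x w (fromℕ< k<N) ⟩
      index x w (toℕ (fromℕ< k<N))      ≡⟨ cong (index x w) (toℕ-fromℕ< k<N) ⟩
      index x (e ++ (h′ ∷ e″)) m        ≡⟨ cong (index x (e ++ (h′ ∷ e″))) (+-identityʳ m) ⟨
      index x (e ++ (h′ ∷ e″)) (m + 0)  ≡⟨ index-++ʳ x e (h′ ∷ e″) 0 ⟩
      h′                                ∎

  -- Rainbow cycles split into disjoint rainbow paths

  halfPath : Vec (Fin n) m → Vec (Fin n) (suc k)
  halfPath e = tabulate (path e ∘ toℕ)

  lookup-halfPath : ∀ e i → lookup (halfPath e) i ≡ path e (toℕ i)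
  lookup-halfPath e = lookup∘tabulate (path e ∘ toℕ)

  edgeCol-halfPath : ∀ e (i : Fin k) →
                     edgeCol G col (halfPath e) i ≡ col (path e (toℕ i)) (path e (suc (toℕ i)))
  edgeCol-halfPath e i = cong₂ col (trans (lookup-halfPath e (inject₁ i)) (cong (path e) (toℕ-inject₁ i)))
                                   (lookup-halfPath e (Fin.suc i))

  module _ (e e′ : Vec (Fin n) m) where

    edgeCol-halfPath-front : ∀ (i : Fin k) →
      edgeCol G col (halfPath e) i ≡ col (vertex e e′ (toℕ i)) (vertex e e′ (suc (toℕ i)))
    edgeCol-halfPath-front i = trans (edgeCol-halfPath e i)
      (sym (cong₂ col (vertex-front e e′ (toℕ i) (<⇒≤ (toℕ<n i))) (vertex-front e e′ (suc (toℕ i)) (toℕ<n i))))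

    -- The cycle traverses e′ backwards, so the symmetry of the colouring is needed.
    edgeCol-halfPath-back : ProperEdgeColouring G col → Walk e′ → ∀ (j : Fin k) →
      edgeCol G col (halfPath e′) j ≡ col (vertex e e′ (k + (m ∸ toℕ j))) (vertex e e′ (suc (k + (m ∸ toℕ j))))
    edgeCol-halfPath-back (col-sym , _) we′ j =
      let front , back , _ = vertex-back-edge e e′ (toℕ j) (toℕ<n j) in
      trans (edgeCol-halfPath e′ j)
            (trans (col-sym (walk-edge we′ (toℕ j) (toℕ<n j))) (sym (cong₂ col front back)))

    module _ (R : RainbowCycle G col (glue e e′)) where

      vertex-injective : ∀ {j j′} → j < N → j′ < N → j ≢ j′ → vertex e e′ j ≢ vertex e e′ j′
      vertex-injective lt lt′ j≢j′ eq =
        proj₁ R (fromℕ< lt) (fromℕ< lt′) (j≢j′ ∘ fromℕ<-injective _ _ lt lt′)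
          (trans (lookup-glue-at e e′ lt) (trans eq (sym (lookup-glue-at e e′ lt′))))

      edgeColour-injective : ∀ {j j′} → j < N → j′ < N → j ≢ j′ →
        col (vertex e e′ j) (vertex e e′ (suc j)) ≢ col (vertex e e′ j′) (vertex e e′ (suc j′))
      edgeColour-injective lt lt′ j≢j′ eq =
        proj₂ R (fromℕ< lt) (fromℕ< lt′) (j≢j′ ∘ fromℕ<-injective _ _ lt lt′)
          (trans (edgeColour-at lt) (trans eq (sym (edgeColour-at lt′))))
        where
        edgeColour-at : ∀ {j} (lt : j < N) →
          col (lookup (glue e e′) (fromℕ< lt)) (lookup (glue e e′) (cyc (fromℕ< lt)))
            ≡ col (vertex e e′ j) (vertex e e′ (suc j))
        edgeColour-at lt = cong₂ col (lookup-glue-at e e′ lt) (lookup-glue-cyc-at e e′ lt)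

      halfPath-rainbow : Walk e → RainbowPath G col x y k (halfPath e)
      halfPath-rainbow we =
        lookup-halfPath e Fin.zero ,
        trans (lookup-halfPath e (fromℕ k)) (trans (cong (path e) (toℕ-fromℕ k)) (path-k e)) ,
        (λ i → subst₂ (Adj G) (sym (trans (lookup-halfPath e (inject₁ i)) (cong (path e) (toℕ-inject₁ i))))
                              (sym (lookup-halfPath e (Fin.suc i))) (we i)) ,
        (λ i j i≢j eq → vertex-injective (on-front i) (on-front j) (i≢j ∘ toℕ-injective)
                          (trans (sym (lookup-front i)) (trans eq (lookup-front j)))) ,
        (λ i j i≢j eq → edgeColour-injective (<-trans (toℕ<n i) k<N) (<-trans (toℕ<n j) k<N)
                          (i≢j ∘ toℕ-injective)
                          (trans (sym (edgeCol-halfPath-front i)) (trans eq (edgeCol-halfPath-front j))))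
        where
        on-front : (i : Fin (suc k)) → toℕ i < N
        on-front i = ≤-<-trans (s≤s⁻¹ (toℕ<n i)) k<N
        lookup-front : ∀ i → lookup (halfPath e) i ≡ vertex e e′ (toℕ i)
        lookup-front i = trans (lookup-halfPath e i) (sym (vertex-front e e′ (toℕ i) (s≤s⁻¹ (toℕ<n i))))

      -- In the cycle, the first half occupies the positions below k, the second half those from k on.
      halfPaths-colour-disjoint : ProperEdgeColouring G col → Walk e′ →
        ∀ (i j : Fin k) → edgeCol G col (halfPath e) i ≢ edgeCol G col (halfPath e′) j
      halfPaths-colour-disjoint pec we′ i j eq =
        let _ , _ , lt = vertex-back-edge e e′ (toℕ j) (toℕ<n j) in
        edgeColour-injective (<-trans (toℕ<n i) k<N) lt (<⇒≢ (<-≤-trans (toℕ<n i) (m≤m+n k _)))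
          (trans (sym (edgeCol-halfPath-front i)) (trans eq (edgeCol-halfPath-back pec we′ j)))

      halfPaths-internally-disjoint : ∀ (i j : Fin (suc k)) → Internal G col i → Internal G col j →
        lookup (halfPath e) i ≢ lookup (halfPath e′) j
      halfPaths-internally-disjoint i j (_ , i<k) (0<j , j<k) eq with toℕ j in j≡
      ... | suc j′ =
        let front , _ , lt = vertex-back-edge e e′ j′ (<-trans (n<1+n j′) j<k) in
        vertex-injective (<-trans i<k k<N) lt (<⇒≢ (<-≤-trans i<k (m≤m+n k _)))
          (begin
            vertex e e′ (toℕ i)                 ≡⟨ vertex-front e e′ (toℕ i) (<⇒≤ i<k) ⟩
            path e (toℕ i)                      ≡⟨ lookup-halfPath e i ⟨
            lookup (halfPath e) i               ≡⟨ eq ⟩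
            lookup (halfPath e′) j              ≡⟨ lookup-halfPath e′ j ⟩
            path e′ (toℕ j)                     ≡⟨ cong (path e′) j≡ ⟩
            path e′ (suc j′)                    ≡⟨ front ⟨
            vertex e e′ (k + (m ∸ j′))          ∎)
        where open ≡-Reasoning

  RainbowGlue : Vec (Fin n) m → Vec (Fin n) m → Set
  RainbowGlue e e′ = Walk e × Walk e′ × RainbowCycle G col (glue e e′)

  rainbowGlue? : ∀ e e′ → Dec (RainbowGlue e e′)
  rainbowGlue? e e′ = walk? e ×-dec walk? e′ ×-dec rainbowCycle? G col (glue e e′)

  nonRainbow : Vec (Fin n) m → Vec (Fin n) m → ℕ
  nonRainbow e e′ = 𝟙 (¬? (rainbowGlue? e e′))

  nonRainbow≡0 : ∀ e e′ → nonRainbow e e′ ≡ 0 → RainbowGlue e e′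
  nonRainbow≡0 e e′ z with rainbowGlue? e e′
  ... | yes r = r

  walks : List (Vec (Fin n) m)
  walks = filter walk? (allVecs n m)

  ∑-closedWalks : (f : Vec (Fin n) N → ℕ) → (∀ w → ¬ InHom G col x y k w → f w ≡ 0) →
    ∑ (allVecs n N) f ≡ ∑ (allVecs n m) (λ e′ → ∑ (allVecs n m) (λ e → f (glue e e′)))
  ∑-closedWalks f z = begin
    ∑ (allVecs n N) f
      ≡⟨ ∑-allVecs-∷ n (m + k) f ⟩
    ∑ (allVecs n (m + k)) (λ v → ∑ (allFin n) (λ h → f (h ∷ v)))
      ≡⟨ ∑-allVecs-++ n m k _ ⟩
    ∑ (allVecs n k) (λ u → ∑ (allVecs n m) (λ e → ∑ (allFin n) (λ h → f (h ∷ (e ++ u)))))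
      ≡⟨ ∑-allVecs-∷ n m _ ⟩
    ∑ (allVecs n m) (λ e″ → ∑ (allFin n) (λ h′ →
      ∑ (allVecs n m) (λ e → ∑ (allFin n) (λ h → f (h ∷ (e ++ (h′ ∷ e″)))))))
      ≡⟨ ∑-cong (allVecs n m) (λ e″ → ∑-cong (allFin n) (λ h′ → ∑-cong (allVecs n m) (λ e →
           ∑-allFin-point x _ (λ h h≢x → z _ (h≢x ∘ proj₁ ∘ inHom-ends h h′ e e″))))) ⟩
    ∑ (allVecs n m) (λ e″ → ∑ (allFin n) (λ h′ → ∑ (allVecs n m) (λ e → f (x ∷ (e ++ (h′ ∷ e″))))))
      ≡⟨ ∑-cong (allVecs n m) (λ e″ → ∑-allFin-point y _ (λ h′ h′≢y →
           ∑-zero (allVecs n m) (λ e → z _ (h′≢y ∘ proj₂ ∘ inHom-ends x h′ e e″)))) ⟩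
    ∑ (allVecs n m) (λ e″ → ∑ (allVecs n m) (λ e → f (x ∷ (e ++ (y ∷ e″)))))
      ≡⟨ ∑-allVecs-reverse n m _ ⟨
    ∑ (allVecs n m) (λ e′ → ∑ (allVecs n m) (λ e → f (glue e e′))) ∎
    where open ≡-Reasoning

  ∑-closedWalks-walks : (f : Vec (Fin n) N → ℕ) → (∀ w → ¬ InHom G col x y k w → f w ≡ 0) →
    ∑ (allVecs n N) f ≡ ∑ walks (λ e′ → ∑ walks (λ e → f (glue e e′)))
  ∑-closedWalks-walks f z = begin
    ∑ (allVecs n N) f
      ≡⟨ ∑-closedWalks f z ⟩
    ∑ (allVecs n m) (λ e′ → ∑ (allVecs n m) (λ e → f (glue e e′)))
      ≡⟨ ∑-filter walk? (allVecs n m) (λ e′ ¬we′ →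
           ∑-zero (allVecs n m) (λ e → z _ (¬we′ ∘ proj₂ ∘ inHom⇒walks e e′))) ⟨
    ∑ walks (λ e′ → ∑ (allVecs n m) (λ e → f (glue e e′)))
      ≡⟨ ∑-filter-cong walk? (allVecs n m) (λ e′ _ →
           sym (∑-filter walk? (allVecs n m) (λ e ¬we → z _ (¬we ∘ proj₁ ∘ inHom⇒walks e e′)))) ⟩
    ∑ walks (λ e′ → ∑ walks (λ e → f (glue e e′))) ∎
    where open ≡-Reasoning

  open FirstMoment walks nonRainbow using (W; Bad; Compatible)

  hom≡W² : hom G col x y k ≡ W * W
  hom≡W² = begin
    hom G col x y k
      ≡⟨ count≡∑𝟙 (inHom? G col x y k) (allVecs n N) ⟩
    ∑ (allVecs n N) (𝟙 ∘ inHom? G col x y k)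
      ≡⟨ ∑-closedWalks-walks _ (λ w → 𝟙≡0 (inHom? G col x y k w)) ⟩
    ∑ walks (λ e′ → ∑ walks (λ e → 𝟙 (inHom? G col x y k (glue e e′))))
      ≡⟨ ∑-filter-cong walk? (allVecs n m) (λ e′ we′ → ∑-filter-cong walk? (allVecs n m) (λ e we →
           𝟙≡1 (inHom? G col x y k (glue e e′)) (glue-inHom we we′))) ⟩
    ∑ walks (λ _ → ∑ walks (λ _ → 1))
      ≡⟨ trans (∑-const walks _) (cong (W *_) (trans (∑-const walks 1) (*-identityʳ W))) ⟩
    W * W ∎
    where open ≡-Reasoning

  hom*≡Bad : hom* G col x y k ≡ Bad
  hom*≡Bad = begin
    hom* G col x y k
      ≡⟨ count≡∑𝟙 (inHom*? G col x y k) (allVecs n N) ⟩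
    ∑ (allVecs n N) (𝟙 ∘ inHom*? G col x y k)
      ≡⟨ ∑-closedWalks-walks _ (λ w → 𝟙≡0 (inHom*? G col x y k w) ∘ (_∘ proj₁)) ⟩
    ∑ walks (λ e′ → ∑ walks (λ e → 𝟙 (inHom*? G col x y k (glue e e′))))
      ≡⟨ ∑-filter-cong walk? (allVecs n m) (λ e′ we′ → ∑-filter-cong walk? (allVecs n m) (λ e we →
           𝟙-cong (inHom*? G col x y k (glue e e′)) (¬? (rainbowGlue? e e′))
             (λ (_ , ¬R) (_ , _ , R) → ¬R R) (λ ¬RG → glue-inHom we we′ , λ R → ¬RG (we , we′ , R)))) ⟩
    ∑ walks (λ e′ → ∑ walks (λ e → nonRainbow e e′))
      ≡⟨ ∑-swap walks walks nonRainbow ⟨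
    Bad ∎
    where open ≡-Reasoning

  compatible⇒disjointRainbowPaths : ∀ {s} → ProperEdgeColouring G col → (t : Vec (Vec (Fin n) m) s) →
    Compatible t → DisjointRainbowPaths G col s x y k
  compatible⇒disjointRainbowPaths pec t (partner , pairwise) =
    halfPath ∘ lookup t , rainbow , colour-disjoint , internally-disjoint
    where
    glued : ∀ {a b} → a ≢ b → RainbowGlue (lookup t a) (lookup t b)
    glued {a} {b} a≢b = nonRainbow≡0 (lookup t a) (lookup t b) (pairwise a b a≢b)
    rainbow : ∀ a → RainbowPath G col x y k (halfPath (lookup t a))
    rainbow a with e′ , z ← partner a with we , _ , R ← nonRainbow≡0 (lookup t a) e′ z =
      halfPath-rainbow (lookup t a) e′ R we
    colour-disjoint : ∀ a b → a ≢ b → ∀ (i j : Fin k) →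
      edgeCol G col (halfPath (lookup t a)) i ≢ edgeCol G col (halfPath (lookup t b)) j
    colour-disjoint a b a≢b with _ , we′ , R ← glued a≢b =
      halfPaths-colour-disjoint (lookup t a) (lookup t b) R pec we′
    internally-disjoint : ∀ a b → a ≢ b → ∀ (i j : Fin (suc k)) → Internal G col i → Internal G col j →
      lookup (halfPath (lookup t a)) i ≢ lookup (halfPath (lookup t b)) j
    internally-disjoint a b a≢b with _ , _ , R ← glued a≢b =
      halfPaths-internally-disjoint (lookup t a) (lookup t b) R

lemma18 : (k s : ℕ) → 1 ≤ k → 1 ≤ s →
          {n : ℕ} (G : Graph n) (col : Fin n → Fin n → ℕ) →
          ProperEdgeColouring G col →
          (x y : Fin n) →
          (s * s) * hom* G col x y k < hom G col x y k →
          DisjointRainbowPaths G col s x y k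
lemma18 (suc m) s _ _ G col pec x y hom*-small =
  let t , compatible = ∃-compatible s (subst₂ (λ h* h → s * s * h* < h) hom*≡Bad hom≡W² hom*-small)
  in compatible⇒disjointRainbowPaths pec t compatible
  where
  open Halves G col x y m
  open FirstMoment walks nonRainbow using (∃-compatible)
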